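{- Let $\rho=\mathrm{Ind}_{\bar\Gamma_0(2)}^{\Gamma}\chi$ be the representation of $\Gamma=\mathrm{PSL}_2(\mathbf{Z})$ induced from a one-dimensional representation $\chi$ of $\bar\Gamma_0(2)$ with finite image, and let $n$ be such that $\chi(\bar U)$ is a primitive $n$-th root of unity. Then $\ker\rho$ is a congruence subgroup of $\Gamma$ if and only if $n\mid 24$.
   Context: $\bar M$ denotes the image in $\mathrm{PSL}_2(\mathbf{Z})$ of a matrix or subgroup $M$ of $\mathrm{SL}_2(\mathbf{Z})$; $\bar\Gamma_0(2)$ is the image of $\Gamma_0(2)$, and $U=\begin{pmatrix}1&0\\2&1\end{pmatrix}$. A subgroup of $\Gamma$ is congruence if it contains $\bar\Gamma(N)$ for some $N\ge1$. -}

module Defs where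

open import Data.Nat as ℕ using (ℕ; suc; NonZero)
open import Data.Integer using (ℤ; +_; -_; _+_; _-_; _*_; 1ℤ; 0ℤ)
open import Data.Integer.Divisibility using (_∣_)
open import Data.Fin using (Fin; zero; suc)
open import Data.Product using (Σ; _×_; _,_)
open import Relation.Binary.PropositionalEquality using (_≡_)
open import Relation.Nullary using (¬_)

record Mat : Set where
  constructor mat
  field
    a b c d : ℤ
open Mat public

det : Mat → ℤ
det (mat a b c d) = a * d - b * c

-- elements of SL₂(ℤ): det = 1.  Elements of PSL₂(ℤ) are handled as
-- ±-invariant predicates/functions on SL₂(ℤ) (no quotient types).
IsSL2 : Mat → Set
IsSL2 A = det A ≡ 1ℤ

_·_ : Mat → Mat → Mat
mat a b c d · mat a' b' c' d' =
  mat (a * a' + b * c') (a * b' + b * d') (c * a' + d * c') (c * b' + d * d')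
infixl 7 _·_

inv : Mat → Mat
inv (mat a b c d) = mat d (- b) (- c) a

I₂ : Mat
I₂ = mat 1ℤ 0ℤ 0ℤ 1ℤ

-I₂ : Mat
-I₂ = mat (- 1ℤ) 0ℤ 0ℤ (- 1ℤ)

U : Mat
U = mat 1ℤ 0ℤ (+ 2) 1ℤ

InΓ₀2 : Mat → Set
InΓ₀2 A = (+ 2) ∣ c A

_≡_[mod_] : ℤ → ℤ → ℕ → Set
x ≡ y [mod m ] = (+ m) ∣ (x - y)
infix 4 _≡_[mod_]

≡I[mod_] : ℕ → Mat → Set
≡I[mod N ] A = (a A ≡ 1ℤ [mod N ]) × (b A ≡ 0ℤ [mod N ]) × (c A ≡ 0ℤ [mod N ]) × (d A ≡ 1ℤ [mod N ])

-- A one-dimensional representation χ of Γ̄₀(2) with finite image: its image is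
-- a finite subgroup of ℂˣ, hence lies in μ_m for some m ≥ 1; we identify μ_m with
-- ℤ/mℤ via k ↦ exp(2πik/m), and represent χ by integer values taken mod m.
record Character (m : ℕ) : Set where
  field
    χ : Mat → ℤ
    hom : ∀ A B → IsSL2 A → IsSL2 B → InΓ₀2 A → InΓ₀2 B →
          χ (A · B) ≡ χ A + χ B [mod m ]
    trivial-on-−I : χ -I₂ ≡ 0ℤ [mod m ]   -- descends to Γ̄₀(2) ⊂ PSL₂(ℤ)
open Character public

-- left coset representatives of Γ₀(2) in SL₂(ℤ): I, S, TS
cosetRep : Fin 3 → Mat
cosetRep zero = I₂
cosetRep (suc zero) = mat 0ℤ (- 1ℤ) 1ℤ 0ℤ
cosetRep (suc (suc zero)) = mat 1ℤ (- 1ℤ) 1ℤ 0ℤ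

-- ρ = Ind χ acts on ⊕_i ℂ e_i by g e_i = χ(r_j⁻¹ g r_i) e_j where g r_i ∈ r_j Γ₀(2)
-- (a monomial matrix).  g ∈ ker ρ iff that monomial matrix is the identity:
-- every coset r_i Γ₀(2) is fixed and every entry χ(r_i⁻¹ g r_i) equals 1.
InKerInd : {m : ℕ} → Character m → Mat → Set
InKerInd {m} ch g = ∀ (i : Fin 3) →
  let h = inv (cosetRep i) · g · cosetRep i in
  InΓ₀2 h × (χ ch h ≡ 0ℤ [mod m ])

IsCongruence : (Mat → Set) → Set
IsCongruence H = Σ ℕ λ N → (1 ℕ.≤ N) × (∀ A → IsSL2 A → ≡I[mod N ] A → H A)

-- x (mod m) has additive order exactly n in ℤ/mℤ, i.e. exp(2πix/m) is a
-- primitive n-th root of unity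
HasOrder : ℕ → ℤ → ℕ → Set
HasOrder m x n = (1 ℕ.≤ n) × (((+ n) * x) ≡ 0ℤ [mod m ]) ×
  (∀ k → 1 ℕ.≤ k → k ℕ.< n → ¬ ((+ k) * x ≡ 0ℤ [mod m ]))

module Submission where

-- Write x = χ(T) and u = χ(U) for T = (1 1; 0 1).  Every h ∈ Γ₀(2) is a word in T, U and -I
-- (Euclid's algorithm on the bottom row of h), and if p and q are the exponent sums of T and U
-- in such a word then χ(h) = p x + q u.  Since E = (1 -1; 2 -1) satisfies E T = U and E² = -I,
-- 2 (u - x) = 0.  Two polynomial functions of the entries of h recover p + q modulo 8 and 3,
-- and c/2 recovers q modulo 2, so if n ∣ 24 (hence 24 u = 24 x = 0) χ vanishes on Γ(48), and so
-- do its conjugates by the coset representatives.  Conversely, if Γ(N) ⊆ ker ρ then U^N ∈ ker χ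
-- gives n ∣ N, and for D ∈ Γ₀(2) with N ∣ b D one has D U D⁻¹ ≡ U^(d²) (mod N), so n ∣ d² - 1
-- whenever d is invertible modulo 2N.  Choosing d ≡ 5 modulo the 3-smooth part of 2N and d ≡ 2
-- modulo the rest makes d² - 1 ≡ 24 and ≡ 3 there, which forces n ∣ 24.

open import Defs
open import Data.Empty using (⊥-elim)
open import Data.Fin using (zero; suc)
open import Data.Integer as ℤ using (ℤ; +_; -[1+_]; +[1+_]; -_; _+_; _-_; _*_; 1ℤ; 0ℤ; ∣_∣)
open import Data.Integer.DivMod using (n%ℕd<d)
import Data.Integer.DivMod as ℤ
open import Data.Integer.Divisibility.Signed as Signed using (divides)
import Data.Integer.Properties as ℤ
open import Data.Integer.Tactic.RingSolver using (solve-∀)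
open import Data.Nat as ℕ using (ℕ; zero; suc; NonZero; _<_; _≤_; s≤s; z≤n)
open import Data.Nat.Divisibility using (_∣_)
import Data.Nat.Divisibility as ℕ
import Data.Nat.DivMod as ℕ
open import Data.Nat.Induction using (<-wellFounded)
import Data.Nat.Properties as ℕ
open import Data.Product using (∃; ∃₂; _×_; _,_; proj₁; proj₂)
open import Data.Sum using (_⊎_; inj₁; inj₂)
open import Function.Base using (_∘_)
open import Function.Bundles using (_⇔_; mk⇔; Equivalence)
open import Induction.WellFounded using (Acc; acc)
open import Relation.Binary.Bundles using (Setoid)
import Relation.Binary.Reasoning.Setoid
open import Relation.Binary.PropositionalEquality as P using (_≡_; _≢_; cong; cong₂; subst; subst₂)
open import Relation.Nullary using (Dec; yes; no; ¬_)
open import Relation.Nullary.Decidable using (map′; True; toWitness; _→-dec_)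

-- Defs' congruence is a function of x - y, so Agda cannot recover x and y from it;
-- the record makes them inferable.
infix 4 _≡_⟨mod_⟩
record _≡_⟨mod_⟩ (x y : ℤ) (k : ℕ) : Set where
  constructor ⟨_⟩
  field divides-diff : (+ k) Signed.∣ x - y

module Mod where

  private variable
    k l : ℕ
    x y z x′ y′ : ℤ

  fromDefs : x ≡ y [mod k ] → x ≡ y ⟨mod k ⟩
  fromDefs k∣x-y = ⟨ Signed.∣ᵤ⇒∣ k∣x-y ⟩

  toDefs : x ≡ y ⟨mod k ⟩ → x ≡ y [mod k ]
  toDefs ⟨ k∣x-y ⟩ = Signed.∣⇒∣ᵤ k∣x-y

  _≟_[mod_] : ∀ x y k → Dec (x ≡ y ⟨mod k ⟩)
  x ≟ y [mod k ] = map′ fromDefs toDefs (k ℕ.∣? ∣ x - y ∣)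

  fromℕ∣ : k ∣ l → + l ≡ 0ℤ ⟨mod k ⟩
  fromℕ∣ {l = l} k∣l = fromDefs (subst (_ ∣_) (cong ∣_∣ (P.sym (ℤ.+-identityʳ (+ l)))) k∣l)

  toℕ∣ : + l ≡ 0ℤ ⟨mod k ⟩ → k ∣ l
  toℕ∣ {l = l} l≡0 = subst (_ ∣_) (cong ∣_∣ (ℤ.+-identityʳ (+ l))) (toDefs l≡0)

  rearrange : ∀ {e} → e ≡ x - y → (+ k) Signed.∣ e → x ≡ y ⟨mod k ⟩
  rearrange {k = k} e≡x-y k∣e = ⟨ subst ((+ k) Signed.∣_) e≡x-y k∣e ⟩

  multiple : ∀ q → x - y ≡ q * + k → x ≡ y ⟨mod k ⟩
  multiple q x-y≡qk = ⟨ divides q x-y≡qk ⟩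

  reflexive : x ≡ y → x ≡ y ⟨mod k ⟩
  reflexive {x = x} P.refl = multiple 0ℤ (ℤ.+-inverseʳ x)

  refl : x ≡ x ⟨mod k ⟩
  refl = reflexive P.refl

  sym : x ≡ y ⟨mod k ⟩ → y ≡ x ⟨mod k ⟩
  sym {x = x} {y = y} ⟨ k∣x-y ⟩ = rearrange (negate x y) (Signed.∣m⇒∣-m k∣x-y)
    where negate : ∀ x y → - (x - y) ≡ y - x
          negate = solve-∀

  trans : x ≡ y ⟨mod k ⟩ → y ≡ z ⟨mod k ⟩ → x ≡ z ⟨mod k ⟩
  trans {x = x} {y = y} {z = z} ⟨ k∣x-y ⟩ ⟨ k∣y-z ⟩ =
    rearrange (telescope x y z) (Signed.∣m∣n⇒∣m+n k∣x-y k∣y-z)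
    where telescope : ∀ x y z → x - y + (y - z) ≡ x - z
          telescope = solve-∀

  setoid : ℕ → Setoid _ _
  setoid k = record
    { Carrier = ℤ
    ; _≈_ = λ x y → x ≡ y ⟨mod k ⟩
    ; isEquivalence = record { refl = refl ; sym = sym ; trans = trans }
    }

  module Reasoning (k : ℕ) = Relation.Binary.Reasoning.Setoid (setoid k)

  +-cong : x ≡ y ⟨mod k ⟩ → x′ ≡ y′ ⟨mod k ⟩ → x + x′ ≡ y + y′ ⟨mod k ⟩
  +-cong {x = x} {y = y} {x′ = x′} {y′ = y′} ⟨ p ⟩ ⟨ q ⟩ =
    rearrange (regroup x y x′ y′) (Signed.∣m∣n⇒∣m+n p q)
    where regroup : ∀ x y x′ y′ → x - y + (x′ - y′) ≡ x + x′ - (y + y′)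
          regroup = solve-∀

  +-congˡ : ∀ z → x ≡ y ⟨mod k ⟩ → z + x ≡ z + y ⟨mod k ⟩
  +-congˡ z = +-cong (refl {x = z})

  +-congʳ : ∀ z → x ≡ y ⟨mod k ⟩ → x + z ≡ y + z ⟨mod k ⟩
  +-congʳ z x≡y = +-cong x≡y (refl {x = z})

  -‿cong : x ≡ y ⟨mod k ⟩ → - x ≡ - y ⟨mod k ⟩
  -‿cong {x = x} {y = y} ⟨ p ⟩ = rearrange (negate x y) (Signed.∣m⇒∣-m p)
    where negate : ∀ x y → - (x - y) ≡ - x - - y
          negate = solve-∀

  *-cong : x ≡ y ⟨mod k ⟩ → x′ ≡ y′ ⟨mod k ⟩ → x * x′ ≡ y * y′ ⟨mod k ⟩
  *-cong {x = x} {y = y} {x′ = x′} {y′ = y′} ⟨ p ⟩ ⟨ q ⟩ =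
    rearrange (regroup x y x′ y′)
      (Signed.∣m∣n⇒∣m+n (Signed.∣m⇒∣m*n x′ p) (Signed.∣n⇒∣m*n y q))
    where regroup : ∀ x y x′ y′ → (x - y) * x′ + y * (x′ - y′) ≡ x * x′ - y * y′
          regroup = solve-∀

  *-congˡ : ∀ z → x ≡ y ⟨mod k ⟩ → z * x ≡ z * y ⟨mod k ⟩
  *-congˡ z = *-cong (refl {x = z})

  +-cancelˡ : x + y ≡ x + z ⟨mod k ⟩ → y ≡ z ⟨mod k ⟩
  +-cancelˡ {x = x} {y = y} {z = z} ⟨ p ⟩ = rearrange (cancel x y z) p
    where cancel : ∀ x y z → x + y - (x + z) ≡ y - z
          cancel = solve-∀

  +-cancelʳ : y + x ≡ z + x ⟨mod k ⟩ → y ≡ z ⟨mod k ⟩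
  +-cancelʳ {y = y} {x = x} {z = z} ⟨ p ⟩ = rearrange (cancel x y z) p
    where cancel : ∀ x y z → y + x - (z + x) ≡ y - z
          cancel = solve-∀

  diff≡0 : x ≡ y ⟨mod k ⟩ → x - y ≡ 0ℤ ⟨mod k ⟩
  diff≡0 {x = x} {y = y} ⟨ p ⟩ = rearrange (P.sym (ℤ.+-identityʳ (x - y))) p

  diff≡0⇒≡ : x - y ≡ 0ℤ ⟨mod k ⟩ → x ≡ y ⟨mod k ⟩
  diff≡0⇒≡ {x = x} {y = y} ⟨ p ⟩ = rearrange (ℤ.+-identityʳ (x - y)) p

  modulus≡0 : + k ≡ 0ℤ ⟨mod k ⟩
  modulus≡0 {k} = multiple 1ℤ (P.trans (ℤ.+-identityʳ (+ k)) (P.sym (ℤ.*-identityˡ (+ k))))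

  weaken : l ∣ k → x ≡ y ⟨mod k ⟩ → x ≡ y ⟨mod l ⟩
  weaken l∣k ⟨ p ⟩ = ⟨ Signed.∣-trans (Signed.∣ᵤ⇒∣ l∣k) p ⟩

  scale : ∀ l → x ≡ y ⟨mod k ⟩ → + l * x ≡ + l * y ⟨mod l ℕ.* k ⟩
  scale {x = x} {y = y} {k = k} l ⟨ divides q x-y≡qk ⟩ = multiple q (begin
    + l * x - + l * y  ≡⟨ factor (+ l) x y ⟩
    + l * (x - y)      ≡⟨ cong (+ l *_) x-y≡qk ⟩
    + l * (q * + k)    ≡⟨ swap (+ l) q (+ k) ⟩
    q * (+ l * + k)    ≡⟨ cong (q *_) (ℤ.pos-* l k) ⟨
    q * + (l ℕ.* k)    ∎)
    where
      open P.≡-Reasoning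
      factor : ∀ l x y → l * x - l * y ≡ l * (x - y)
      factor = solve-∀
      swap : ∀ l q k → l * (q * k) ≡ q * (l * k)
      swap = solve-∀

  cancel : ∀ l .{{_ : NonZero l}} → + l * x ≡ + l * y ⟨mod l ℕ.* k ⟩ → x ≡ y ⟨mod k ⟩
  cancel {x = x} {y = y} {k = k} l ⟨ p ⟩ =
    ⟨ Signed.*-cancelˡ-∣ (+ l) (subst₂ Signed._∣_ (ℤ.pos-* l k) (factor (+ l) x y) p) ⟩
    where factor : ∀ l x y → l * x - l * y ≡ l * (x - y)
          factor = solve-∀

  annihilate : + k * y ≡ 0ℤ ⟨mod l ⟩ → x ≡ 0ℤ ⟨mod k ⟩ → x * y ≡ 0ℤ ⟨mod l ⟩
  annihilate {k = k} {y = y} {l = l} {x = x} ky≡0 ⟨ divides q x-0≡qk ⟩ = begin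
    x * y            ≡⟨ cong (_* y) (P.trans (P.sym (ℤ.+-identityʳ x)) x-0≡qk) ⟩
    q * + k * y      ≡⟨ ℤ.*-assoc q (+ k) y ⟩
    q * (+ k * y)    ≈⟨ *-congˡ q ky≡0 ⟩
    q * 0ℤ           ≡⟨ ℤ.*-zeroʳ q ⟩
    0ℤ               ∎
    where open Reasoning l

  residue : ∀ x k .{{_ : NonZero k}} → x ≡ + (x ℤ.%ℕ k) ⟨mod k ⟩
  residue x k = multiple (x ℤ./ℕ k) (begin
    x - + r                         ≡⟨ cong (_- + r) (ℤ.a≡a%ℕn+[a/ℕn]*n x k) ⟩
    + r + (x ℤ./ℕ k) * + k - + r    ≡⟨ cancel-+ (+ r) ((x ℤ./ℕ k) * + k) ⟩
    (x ℤ./ℕ k) * + k                ∎)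
    where
      open P.≡-Reasoning
      r = x ℤ.%ℕ k
      cancel-+ : ∀ r s → r + s - r ≡ s
      cancel-+ = solve-∀

private variable
  k l : ℕ
  A B C A′ B′ g h : Mat

Bézout : ℤ → ℤ → Set
Bézout x y = ∃₂ λ α β → α * x + β * y ≡ 1ℤ

Bézout-sym : ∀ {x y} → Bézout x y → Bézout y x
Bézout-sym {x} {y} (α , β , αx+βy≡1) = β , α , P.trans (ℤ.+-comm (β * y) (α * x)) αx+βy≡1

Bézout-*ʳ : ∀ {x y z} → Bézout x y → Bézout x z → Bézout x (y * z)
Bézout-*ʳ {x} {y} {z} (α , β , αx+βy≡1) (α′ , β′ , α′x+β′z≡1) =
  γ , β * β′ , (begin
    γ * x + β * β′ * (y * z)             ≡⟨ expand x y z α β α′ β′ ⟩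
    (α * x + β * y) * (α′ * x + β′ * z)  ≡⟨ cong₂ _*_ αx+βy≡1 α′x+β′z≡1 ⟩
    1ℤ                                   ∎)
  where
    open P.≡-Reasoning
    γ = α * α′ * x + α * β′ * z + β * α′ * y
    expand : ∀ x y z α β α′ β′ → (α * α′ * x + α * β′ * z + β * α′ * y) * x + β * β′ * (y * z)
                                 ≡ (α * x + β * y) * (α′ * x + β′ * z)
    expand = solve-∀

Bézout-*ˡ : ∀ {x y z} → Bézout x z → Bézout y z → Bézout (x * y) z
Bézout-*ˡ x⊥z y⊥z = Bézout-sym (Bézout-*ʳ (Bézout-sym x⊥z) (Bézout-sym y⊥z))

Bézout-cong : ∀ {x y} → x ≡ y ⟨mod k ⟩ → Bézout y (+ k) → Bézout x (+ k)
Bézout-cong {k} {x} {y} ⟨ divides q x-y≡qk ⟩ (α , β , αy+βk≡1) = α , β - α * q , (begin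
  α * x + (β - α * q) * + k                      ≡⟨ regroup x y α β q (+ k) ⟩
  α * (x - y) + (α * y + β * + k) - α * q * + k
    ≡⟨ cong₂ (λ s t → α * s + t - α * q * + k) x-y≡qk αy+βk≡1 ⟩
  α * (q * + k) + 1ℤ - α * q * + k               ≡⟨ cancel α q (+ k) ⟩
  1ℤ                                             ∎)
  where
    open P.≡-Reasoning
    regroup : ∀ x y α β q k → α * x + (β - α * q) * k ≡ α * (x - y) + (α * y + β * k) - α * q * k
    regroup = solve-∀
    cancel : ∀ α q k → α * (q * k) + 1ℤ - α * q * k ≡ 1ℤ
    cancel = solve-∀

chinese-remainder : Bézout (+ k) (+ l) → ∀ r s → ∃ λ w → w ≡ r ⟨mod k ⟩ × w ≡ s ⟨mod l ⟩
chinese-remainder {k} {l} (α , β , αk+βl≡1) r s =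
  w , Mod.multiple ((s - r) * α) w≡r , Mod.multiple ((r - s) * β) w≡s
  where
    w = r * (β * + l) + s * (α * + k)
    times-one : ∀ t → t ≡ t * (α * + k + β * + l)
    times-one t = P.sym (P.trans (cong (t *_) αk+βl≡1) (ℤ.*-identityʳ t))
    collect-r : ∀ r s α β k l → r * (β * l) + s * (α * k) - r * (α * k + β * l) ≡ (s - r) * α * k
    collect-r = solve-∀
    collect-s : ∀ r s α β k l → r * (β * l) + s * (α * k) - s * (α * k + β * l) ≡ (r - s) * β * l
    collect-s = solve-∀
    w≡r : w - r ≡ (s - r) * α * + k
    w≡r = P.trans (cong (λ t → w - t) (times-one r)) (collect-r r s α β (+ k) (+ l))
    w≡s : w - s ≡ (r - s) * β * + l
    w≡s = P.trans (cong (λ t → w - t) (times-one s)) (collect-s r s α β (+ k) (+ l))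

≡0-mod-* : ∀ {x} → Bézout (+ k) (+ l) →
           x ≡ 0ℤ ⟨mod k ⟩ → x ≡ 0ℤ ⟨mod l ⟩ → x ≡ 0ℤ ⟨mod k ℕ.* l ⟩
≡0-mod-* {k} {l} {x} (α , β , αk+βl≡1) x≡0[k] x≡0[l] = begin
  x                                ≡⟨ P.trans (P.sym (ℤ.*-identityʳ x)) (cong (x *_) (P.sym αk+βl≡1)) ⟩
  x * (α * + k + β * + l)          ≡⟨ regroup x α β (+ k) (+ l) ⟩
  α * (+ k * x) + β * (+ l * x)    ≈⟨ Mod.+-cong (Mod.*-congˡ α kx≡0) (Mod.*-congˡ β lx≡0) ⟩
  α * (+ k * 0ℤ) + β * (+ l * 0ℤ)  ≡⟨ vanish α β (+ k) (+ l) ⟩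
  0ℤ                               ∎
  where
    open Mod.Reasoning (k ℕ.* l)
    regroup : ∀ x α β k l → x * (α * k + β * l) ≡ α * (k * x) + β * (l * x)
    regroup = solve-∀
    vanish : ∀ α β k l → α * (k * 0ℤ) + β * (l * 0ℤ) ≡ 0ℤ
    vanish = solve-∀
    kx≡0 : + k * x ≡ + k * 0ℤ ⟨mod k ℕ.* l ⟩
    kx≡0 = Mod.scale k x≡0[l]
    lx≡0 : + l * x ≡ + l * 0ℤ ⟨mod k ℕ.* l ⟩
    lx≡0 = subst (λ kl → + l * x ≡ + l * 0ℤ ⟨mod kl ⟩) (ℕ.*-comm l k) (Mod.scale l x≡0[k])

T : Mat
T = mat 1ℤ 1ℤ 0ℤ 1ℤ

Tᵏ Uᵏ : ℤ → Mat
Tᵏ j = mat 1ℤ j 0ℤ 1ℤ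
Uᵏ j = mat 1ℤ 0ℤ (+ 2 * j) 1ℤ

mat-cong : ∀ {a b c d a′ b′ c′ d′} →
           a ≡ a′ → b ≡ b′ → c ≡ c′ → d ≡ d′ → mat a b c d ≡ mat a′ b′ c′ d′
mat-cong P.refl P.refl P.refl P.refl = P.refl

Tᵏ-·T : ∀ j → Tᵏ j · T ≡ Tᵏ (1ℤ + j)
Tᵏ-·T j = mat-cong (upper-left j) (upper-right j) P.refl P.refl
  where upper-left : ∀ j → 1ℤ * 1ℤ + j * 0ℤ ≡ 1ℤ
        upper-left = solve-∀
        upper-right : ∀ j → 1ℤ * 1ℤ + j * 1ℤ ≡ 1ℤ + j
        upper-right = solve-∀

Uᵏ-+ : ∀ i j → Uᵏ i · Uᵏ j ≡ Uᵏ (i + j)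
Uᵏ-+ i j = mat-cong P.refl P.refl (lower-left i j) (lower-right i)
  where lower-left : ∀ i j → + 2 * i * 1ℤ + 1ℤ * (+ 2 * j) ≡ + 2 * (i + j)
        lower-left = solve-∀
        lower-right : ∀ i → + 2 * i * 0ℤ + 1ℤ * 1ℤ ≡ 1ℤ
        lower-right = solve-∀

Uᵏ-neg : ∀ j → Uᵏ (- j) ≡ inv (Uᵏ j)
Uᵏ-neg j = cong (λ c → mat 1ℤ 0ℤ c 1ℤ) (P.sym (ℤ.neg-distribʳ-* (+ 2) j))

·-assoc : ∀ A B C → A · B · C ≡ A · (B · C)
·-assoc (mat a b c d) (mat a′ b′ c′ d′) (mat a″ b″ c″ d″) =
  mat-cong (entry a b a″ c″) (entry a b b″ d″) (entry c d a″ c″) (entry c d b″ d″)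
  where
    entry : ∀ x y x′ y′ → (x * a′ + y * c′) * x′ + (x * b′ + y * d′) * y′
                          ≡ x * (a′ * x′ + b′ * y′) + y * (c′ * x′ + d′ * y′)
    entry x y x′ y′ = expand x y a′ b′ c′ d′ x′ y′
      where expand : ∀ x y a′ b′ c′ d′ x′ y′ → (x * a′ + y * c′) * x′ + (x * b′ + y * d′) * y′
                                               ≡ x * (a′ * x′ + b′ * y′) + y * (c′ * x′ + d′ * y′)
            expand = solve-∀

·-identityˡ : ∀ A → I₂ · A ≡ A
·-identityˡ (mat a b c d) = mat-cong (upper a c) (upper b d) (lower a c) (lower b d)
  where upper : ∀ x y → 1ℤ * x + 0ℤ * y ≡ x
        upper = solve-∀
        lower : ∀ x y → 0ℤ * x + 1ℤ * y ≡ y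
        lower = solve-∀

·-identityʳ : ∀ A → A · I₂ ≡ A
·-identityʳ (mat a b c d) = mat-cong (left a b) (right a b) (left c d) (right c d)
  where left : ∀ x y → x * 1ℤ + y * 0ℤ ≡ x
        left = solve-∀
        right : ∀ x y → x * 0ℤ + y * 1ℤ ≡ y
        right = solve-∀

·-inverseʳ : IsSL2 A → A · inv A ≡ I₂
·-inverseʳ {mat a b c d} det≡1 =
  mat-cong (P.trans (upper-left a b c d) det≡1) (upper-right a b)
           (lower-left c d) (P.trans (lower-right a b c d) det≡1)
  where upper-left : ∀ a b c d → a * d + b * - c ≡ a * d - b * c
        upper-left = solve-∀
        upper-right : ∀ a b → a * - b + b * a ≡ 0ℤ
        upper-right = solve-∀
        lower-left : ∀ c d → c * d + d * - c ≡ 0ℤ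
        lower-left = solve-∀
        lower-right : ∀ a b c d → c * - b + d * a ≡ a * d - b * c
        lower-right = solve-∀

·-inverseˡ : IsSL2 A → inv A · A ≡ I₂
·-inverseˡ {mat a b c d} det≡1 =
  mat-cong (P.trans (upper-left a b c d) det≡1) (upper-right b d)
           (lower-left a c) (P.trans (lower-right a b c d) det≡1)
  where upper-left : ∀ a b c d → d * a + - b * c ≡ a * d - b * c
        upper-left = solve-∀
        upper-right : ∀ b d → d * b + - b * d ≡ 0ℤ
        upper-right = solve-∀
        lower-left : ∀ a c → - c * a + a * c ≡ 0ℤ
        lower-left = solve-∀
        lower-right : ∀ a b c d → - c * b + a * d ≡ a * d - b * c
        lower-right = solve-∀

·-inv-·-cancel : ∀ A → IsSL2 B → A · inv B · B ≡ A
·-inv-·-cancel {B} A det≡1 =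
  P.trans (·-assoc A (inv B) B) (P.trans (cong (A ·_) (·-inverseˡ {B} det≡1)) (·-identityʳ A))

·-I≡negate : ∀ A → A · -I₂ ≡ mat (- a A) (- b A) (- c A) (- d A)
·-I≡negate (mat a b c d) = mat-cong (left a b) (right a b) (left c d) (right c d)
  where left : ∀ x y → x * - 1ℤ + y * 0ℤ ≡ - x
        left = solve-∀
        right : ∀ x y → x * 0ℤ + y * - 1ℤ ≡ - y
        right = solve-∀

conjugate-U : ∀ A → A · U · inv A ≡ mat (det A + + 2 * b A * d A) (- (+ 2 * b A * b A))
                                        (+ 2 * d A * d A)         (det A - + 2 * b A * d A)
conjugate-U (mat a b c d) = mat-cong (upper-left a b c d) (upper-right a b) (lower-left c d) (lower-right a b c d)
  where
    upper-left : ∀ a b c d → (a * 1ℤ + b * + 2) * d + (a * 0ℤ + b * 1ℤ) * - c ≡ a * d - b * c + + 2 * b * d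
    upper-left = solve-∀
    upper-right : ∀ a b → (a * 1ℤ + b * + 2) * - b + (a * 0ℤ + b * 1ℤ) * a ≡ - (+ 2 * b * b)
    upper-right = solve-∀
    lower-left : ∀ c d → (c * 1ℤ + d * + 2) * d + (c * 0ℤ + d * 1ℤ) * - c ≡ + 2 * d * d
    lower-left = solve-∀
    lower-right : ∀ a b c d → (c * 1ℤ + d * + 2) * - b + (c * 0ℤ + d * 1ℤ) * a ≡ a * d - b * c - + 2 * b * d
    lower-right = solve-∀

det-· : ∀ A B → det (A · B) ≡ det A * det B
det-· (mat a b c d) (mat a′ b′ c′ d′) = expand a b c d a′ b′ c′ d′
  where expand : ∀ a b c d a′ b′ c′ d′ → (a * a′ + b * c′) * (c * b′ + d * d′) - (a * b′ + b * d′) * (c * a′ + d * c′)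
                                         ≡ (a * d - b * c) * (a′ * d′ - b′ * c′)
        expand = solve-∀

det-inv : ∀ A → det (inv A) ≡ det A
det-inv (mat a b c d) = expand a b c d
  where expand : ∀ a b c d → d * a - - b * - c ≡ a * d - b * c
        expand = solve-∀

SL2-· : IsSL2 A → IsSL2 B → IsSL2 (A · B)
SL2-· {A} {B} detA≡1 detB≡1 = P.trans (det-· A B) (cong₂ _*_ detA≡1 detB≡1)

SL2-inv : IsSL2 A → IsSL2 (inv A)
SL2-inv {A} detA≡1 = P.trans (det-inv A) detA≡1

cosetRep-SL2 : ∀ i → IsSL2 (cosetRep i)
cosetRep-SL2 zero = P.refl
cosetRep-SL2 (suc zero) = P.refl
cosetRep-SL2 (suc (suc zero)) = P.refl

record IsΓ₀2 (A : Mat) : Set where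
  constructor mkΓ₀2
  field
    sl2 : IsSL2 A
    c-even : InΓ₀2 A
open IsΓ₀2

2∣c⇒InΓ₀2 : (+ 2) Signed.∣ c A → InΓ₀2 A
2∣c⇒InΓ₀2 {A} = Signed.∣⇒∣ᵤ {+ 2} {c A}

InΓ₀2⇒2∣c : InΓ₀2 A → (+ 2) Signed.∣ c A
InΓ₀2⇒2∣c {A} = Signed.∣ᵤ⇒∣ {+ 2} {c A}

even : ∀ A q → c A ≡ q * + 2 → InΓ₀2 A
even A q c≡2q = 2∣c⇒InΓ₀2 {A} (divides q c≡2q)

Γ₀2-· : IsΓ₀2 A → IsΓ₀2 B → IsΓ₀2 (A · B)
Γ₀2-· {A} {B} (mkΓ₀2 slA γA) (mkΓ₀2 slB γB) = mkΓ₀2 (SL2-· {A} {B} slA slB) (2∣c⇒InΓ₀2 {A · B}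
  (Signed.∣m∣n⇒∣m+n (Signed.∣m⇒∣m*n (a B) (InΓ₀2⇒2∣c {A} γA))
                    (Signed.∣n⇒∣m*n (d A) (InΓ₀2⇒2∣c {B} γB))))

Γ₀2-inv : IsΓ₀2 A → IsΓ₀2 (inv A)
Γ₀2-inv {A} (mkΓ₀2 sl γ) =
  mkΓ₀2 (SL2-inv {A} sl) (2∣c⇒InΓ₀2 {inv A} (Signed.∣m⇒∣-m (InΓ₀2⇒2∣c {A} γ)))

Γ₀2-I : IsΓ₀2 I₂
Γ₀2-I = mkΓ₀2 P.refl (even I₂ 0ℤ P.refl)

Γ₀2-T : IsΓ₀2 T
Γ₀2-T = mkΓ₀2 P.refl (even T 0ℤ P.refl)

Γ₀2-U : IsΓ₀2 U
Γ₀2-U = mkΓ₀2 P.refl (even U 1ℤ P.refl)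

Γ₀2--I : IsΓ₀2 -I₂
Γ₀2--I = mkΓ₀2 P.refl (even -I₂ 0ℤ P.refl)

Γ₀2-Tᵏ : ∀ j → IsΓ₀2 (Tᵏ j)
Γ₀2-Tᵏ j = mkΓ₀2 (unimodular j) (even (Tᵏ j) 0ℤ P.refl)
  where unimodular : ∀ j → 1ℤ * 1ℤ - j * 0ℤ ≡ 1ℤ
        unimodular = solve-∀

Γ₀2-Uᵏ : ∀ j → IsΓ₀2 (Uᵏ j)
Γ₀2-Uᵏ j = mkΓ₀2 (unimodular j) (even (Uᵏ j) j (ℤ.*-comm (+ 2) j))
  where unimodular : ∀ j → 1ℤ * 1ℤ - 0ℤ * (+ 2 * j) ≡ 1ℤ
        unimodular = solve-∀

infix 4 _≡ᴹ_⟨mod_⟩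
record _≡ᴹ_⟨mod_⟩ (A B : Mat) (k : ℕ) : Set where
  constructor entrywise
  field
    a≡ : a A ≡ a B ⟨mod k ⟩
    b≡ : b A ≡ b B ⟨mod k ⟩
    c≡ : c A ≡ c B ⟨mod k ⟩
    d≡ : d A ≡ d B ⟨mod k ⟩
open _≡ᴹ_⟨mod_⟩

≡ᴹ-reflexive : A ≡ B → A ≡ᴹ B ⟨mod k ⟩
≡ᴹ-reflexive P.refl = entrywise Mod.refl Mod.refl Mod.refl Mod.refl

≡ᴹ-trans : A ≡ᴹ B ⟨mod k ⟩ → B ≡ᴹ C ⟨mod k ⟩ → A ≡ᴹ C ⟨mod k ⟩
≡ᴹ-trans (entrywise a₁ b₁ c₁ d₁) (entrywise a₂ b₂ c₂ d₂) =
  entrywise (Mod.trans a₁ a₂) (Mod.trans b₁ b₂) (Mod.trans c₁ c₂) (Mod.trans d₁ d₂)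

≡ᴹ-weaken : l ∣ k → A ≡ᴹ B ⟨mod k ⟩ → A ≡ᴹ B ⟨mod l ⟩
≡ᴹ-weaken l∣k (entrywise a≡ b≡ c≡ d≡) =
  entrywise (Mod.weaken l∣k a≡) (Mod.weaken l∣k b≡) (Mod.weaken l∣k c≡) (Mod.weaken l∣k d≡)

fromΓ : ≡I[mod k ] A → A ≡ᴹ I₂ ⟨mod k ⟩
fromΓ (a≡1 , b≡0 , c≡0 , d≡1) =
  entrywise (Mod.fromDefs a≡1) (Mod.fromDefs b≡0) (Mod.fromDefs c≡0) (Mod.fromDefs d≡1)

toΓ : A ≡ᴹ I₂ ⟨mod k ⟩ → ≡I[mod k ] A
toΓ (entrywise a≡1 b≡0 c≡0 d≡1) = Mod.toDefs a≡1 , Mod.toDefs b≡0 , Mod.toDefs c≡0 , Mod.toDefs d≡1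

·-cong : A ≡ᴹ A′ ⟨mod k ⟩ → B ≡ᴹ B′ ⟨mod k ⟩ → A · B ≡ᴹ A′ · B′ ⟨mod k ⟩
·-cong (entrywise a₁ b₁ c₁ d₁) (entrywise a₂ b₂ c₂ d₂) = entrywise
  (Mod.+-cong (Mod.*-cong a₁ a₂) (Mod.*-cong b₁ c₂))
  (Mod.+-cong (Mod.*-cong a₁ b₂) (Mod.*-cong b₁ d₂))
  (Mod.+-cong (Mod.*-cong c₁ a₂) (Mod.*-cong d₁ c₂))
  (Mod.+-cong (Mod.*-cong c₁ b₂) (Mod.*-cong d₁ d₂))

·-congˡ : ∀ C → A ≡ᴹ B ⟨mod k ⟩ → A · C ≡ᴹ B · C ⟨mod k ⟩
·-congˡ C A≡B = ·-cong A≡B (≡ᴹ-reflexive {A = C} P.refl)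

·-congʳ : ∀ C → A ≡ᴹ B ⟨mod k ⟩ → C · A ≡ᴹ C · B ⟨mod k ⟩
·-congʳ C A≡B = ·-cong (≡ᴹ-reflexive {A = C} P.refl) A≡B

det-cong : A ≡ᴹ B ⟨mod k ⟩ → det A ≡ det B ⟨mod k ⟩
det-cong (entrywise a≡ b≡ c≡ d≡) = Mod.+-cong (Mod.*-cong a≡ d≡) (Mod.-‿cong (Mod.*-cong b≡ c≡))

Γ-normal : ∀ B → IsSL2 B → A ≡ᴹ I₂ ⟨mod k ⟩ → inv B · A · B ≡ᴹ I₂ ⟨mod k ⟩
Γ-normal B sl A≡I = ≡ᴹ-trans (·-congˡ B (·-congʳ (inv B) A≡I))
  (≡ᴹ-reflexive (P.trans (cong (_· B) (·-identityʳ (inv B))) (·-inverseˡ {B} sl)))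

Γ[2]⊆Γ₀2 : A ≡ᴹ I₂ ⟨mod 2 ⟩ → InΓ₀2 A
Γ[2]⊆Γ₀2 {A} (entrywise _ _ ⟨ 2∣c-0 ⟩ _) =
  2∣c⇒InΓ₀2 {A} (subst (+ 2 Signed.∣_) (ℤ.+-identityʳ (c A)) 2∣c-0)

conjugate-U≡Uᵏ : IsSL2 A → b A ≡ 0ℤ ⟨mod k ⟩ → A · U · inv A ≡ᴹ Uᵏ (d A * d A) ⟨mod k ⟩
conjugate-U≡Uᵏ {A} det≡1 b≡0 = ≡ᴹ-trans (≡ᴹ-reflexive (conjugate-U A)) (entrywise
  (Mod.+-cong (Mod.reflexive det≡1) 2bd≡0)
  (Mod.-‿cong (Mod.*-cong (Mod.*-congˡ (+ 2) b≡0) b≡0))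
  (Mod.reflexive (ℤ.*-assoc (+ 2) (d A) (d A)))
  (Mod.+-cong (Mod.reflexive det≡1) (Mod.-‿cong 2bd≡0)))
  where 2bd≡0 = Mod.*-cong (Mod.*-congˡ (+ 2) b≡0) (Mod.refl {x = d A})

-- For f and g respecting congruence mod K, f ≡ g (mod K) holds on Γ₀(2) as soon as it holds on
-- the finitely many residues of (a, b, c/2, d) with det ≡ 1; these are checked by evaluation.

residueMat : ℕ → ℕ → ℕ → ℕ → Mat
residueMat a b j d = mat (+ a) (+ b) (+ 2 * + j) (+ d)

module _ (K : ℕ) .{{_ : NonZero K}} (f g : Mat → ℤ) where

  AgreeOnResidues : Set
  AgreeOnResidues = ∀ {a} → a < K → ∀ {b} → b < K → ∀ {j} → j < K → ∀ {d} → d < K →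
    let R = residueMat a b j d in det R ≡ 1ℤ ⟨mod K ⟩ → f R ≡ g R ⟨mod K ⟩

  agreeOnResidues? : Dec AgreeOnResidues
  agreeOnResidues? =
    ℕ.allUpTo? (λ a → ℕ.allUpTo? (λ b → ℕ.allUpTo? (λ j → ℕ.allUpTo? (λ d →
      let R = residueMat a b j d in (det R Mod.≟ 1ℤ [mod K ]) →-dec (f R Mod.≟ g R [mod K ])) K) K) K) K

  by-residues : (∀ {A B} → A ≡ᴹ B ⟨mod K ⟩ → f A ≡ f B ⟨mod K ⟩) →
                (∀ {A B} → A ≡ᴹ B ⟨mod K ⟩ → g A ≡ g B ⟨mod K ⟩) →
                {_ : True agreeOnResidues?} → ∀ {A} → IsΓ₀2 A → f A ≡ g A ⟨mod K ⟩
  by-residues f-cong g-cong {agree} {mat a b c d} (mkΓ₀2 det≡1 γ) with InΓ₀2⇒2∣c {mat a b c d} γ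
  ... | divides j c≡2j = begin
    f M  ≈⟨ f-cong M≡R ⟩
    f R  ≈⟨ toWitness agree (n%ℕd<d a K) (n%ℕd<d b K) (n%ℕd<d j K) (n%ℕd<d d K) det-R≡1 ⟩
    g R  ≈⟨ g-cong M≡R ⟨
    g M  ∎
    where
      open Mod.Reasoning K
      M = mat a b c d
      R = residueMat (a ℤ.%ℕ K) (b ℤ.%ℕ K) (j ℤ.%ℕ K) (d ℤ.%ℕ K)
      M≡R : M ≡ᴹ R ⟨mod K ⟩
      M≡R = entrywise (Mod.residue a K) (Mod.residue b K)
        (Mod.trans (Mod.reflexive (P.trans c≡2j (ℤ.*-comm j (+ 2)))) (Mod.*-congˡ (+ 2) (Mod.residue j K)))
        (Mod.residue d K)
      det-R≡1 : det R ≡ 1ℤ ⟨mod K ⟩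
      det-R≡1 = Mod.trans (Mod.sym (det-cong M≡R)) (Mod.reflexive det≡1)

shift-by-residues : ∀ K .{{_ : NonZero K}} (Φ : Mat → ℤ) → (∀ {A B} → A ≡ᴹ B ⟨mod K ⟩ → Φ A ≡ Φ B ⟨mod K ⟩) →
                    ∀ g δ → {_ : True (agreeOnResidues? K (λ A → Φ (A · g)) (λ A → Φ A + δ))} →
                    IsΓ₀2 h → Φ (h · g) ≡ Φ h + δ ⟨mod K ⟩
shift-by-residues K Φ Φ-cong g δ {agree} =
  by-residues K _ _ (Φ-cong ∘ ·-congˡ g) (Mod.+-congʳ δ ∘ Φ-cong) {agree}

d-odd : IsΓ₀2 h → d h ≡ 1ℤ ⟨mod 2 ⟩
d-odd = by-residues 2 d (λ _ → 1ℤ) d≡ (λ _ → Mod.refl)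

d≢0 : IsΓ₀2 h → d h ≢ 0ℤ
d≢0 γ d≡0 = 2≢1 (ℕ.∣1⇒≡1 (Mod.toDefs (Mod.trans (Mod.reflexive (P.sym d≡0)) (d-odd γ))))
  where 2≢1 : 2 ≢ 1
        2≢1 ()

-- Γ₀(2) is generated by T, U and -I

∣i∣≡1 : ∀ i → ∣ i ∣ ≡ 1 → i ≡ 1ℤ ⊎ i ≡ - 1ℤ
∣i∣≡1 (+ 1)    _ = inj₁ P.refl
∣i∣≡1 -[1+ 0 ] _ = inj₂ P.refl

i*j≡1 : ∀ i j → i * j ≡ 1ℤ → (i ≡ 1ℤ × j ≡ 1ℤ) ⊎ (i ≡ - 1ℤ × j ≡ - 1ℤ)
i*j≡1 i j ij≡1
  with ∣i∣≡1 i (ℕ.m*n≡1⇒m≡1 ∣ i ∣ ∣ j ∣ ∣ij∣≡1) | ∣i∣≡1 j (ℕ.m*n≡1⇒n≡1 ∣ i ∣ ∣ j ∣ ∣ij∣≡1)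
  where ∣ij∣≡1 = P.trans (P.sym (ℤ.abs-* i j)) (cong ∣_∣ ij≡1)
... | inj₁ P.refl | inj₁ P.refl = inj₁ (P.refl , P.refl)
... | inj₂ P.refl | inj₂ P.refl = inj₂ (P.refl , P.refl)
... | inj₁ P.refl | inj₂ P.refl with () ← ij≡1
... | inj₂ P.refl | inj₁ P.refl with () ← ij≡1

∣m-n∣<m : ∀ m n → 0 < n → n < m ℕ.+ m → ∣ + m - + n ∣ < m
∣m-n∣<m m n 0<n n<2m with n ℕ.≤? m
... | yes n≤m = begin-strict
  ∣ + m - + n ∣  ≡⟨ cong ∣_∣ (P.trans (ℤ.m-n≡m⊖n m n) (ℤ.⊖-≥ n≤m)) ⟩
  m ℕ.∸ n        <⟨ ℕ.∸-monoʳ-< 0<n n≤m ⟩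
  m ℕ.∸ 0        ∎
  where open ℕ.≤-Reasoning
... | no n≰m = begin-strict
  ∣ + m - + n ∣  ≡⟨ P.trans (cong ∣_∣ (ℤ.m-n≡m⊖n m n)) (ℤ.∣⊖∣-≰ n≰m) ⟩
  n ℕ.∸ m        <⟨ ℕ.∸-monoˡ-< n<2m (ℕ.<⇒≤ (ℕ.≰⇒> n≰m)) ⟩
  m ℕ.+ m ℕ.∸ m  ≡⟨ ℕ.m+n∸n≡m m m ⟩
  m              ∎
  where open ℕ.≤-Reasoning

∣D-C∣<D : ∀ {C D} → suc C ≤ suc D → ∣ + suc D - + suc C ∣ < suc D
∣D-C∣<D {D = D} C≤D =
  ∣m-n∣<m (suc D) _ (s≤s z≤n) (ℕ.≤-<-trans C≤D (ℕ.m<m+n (suc D) (s≤s z≤n)))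

∣C-2D∣<C : ∀ {C D} → ¬ suc C ≤ suc D → ∣ + suc C - + (suc D ℕ.+ suc D) ∣ < suc C
∣C-2D∣<C {C} C≰D = ∣m-n∣<m (suc C) _ (s≤s z≤n) (ℕ.+-mono-< (ℕ.≰⇒> C≰D) (ℕ.≰⇒> C≰D))

rowSize : Mat → ℕ
rowSize h = ∣ c h ∣ ℕ.+ ∣ d h ∣

rowSize-·T : ∀ A → rowSize (A · T) ≡ ∣ c A ∣ ℕ.+ ∣ - d A - c A ∣
rowSize-·T (mat a b c d) =
  cong₂ ℕ._+_ (cong ∣_∣ (left c d)) (P.trans (cong ∣_∣ (right c d)) (ℤ.∣-i∣≡∣i∣ (- d - c)))
  where left : ∀ c d → c * 1ℤ + d * 0ℤ ≡ c
        left = solve-∀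
        right : ∀ c d → c * 1ℤ + d * 1ℤ ≡ - (- d - c)
        right = solve-∀

rowSize-·T⁻¹ : ∀ A → rowSize (A · inv T) ≡ ∣ c A ∣ ℕ.+ ∣ d A - c A ∣
rowSize-·T⁻¹ (mat a b c d) = cong₂ (λ x y → ∣ x ∣ ℕ.+ ∣ y ∣) (left c d) (right c d)
  where left : ∀ c d → c * 1ℤ + d * 0ℤ ≡ c
        left = solve-∀
        right : ∀ c d → c * - 1ℤ + d * 1ℤ ≡ d - c
        right = solve-∀

rowSize-·U : ∀ A → rowSize (A · U) ≡ ∣ c A - (- d A + - d A) ∣ ℕ.+ ∣ d A ∣
rowSize-·U (mat a b c d) = cong₂ (λ x y → ∣ x ∣ ℕ.+ ∣ y ∣) (left c d) (right c d)
  where left : ∀ c d → c * 1ℤ + d * + 2 ≡ c - (- d + - d)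
        left = solve-∀
        right : ∀ c d → c * 0ℤ + d * 1ℤ ≡ d
        right = solve-∀

rowSize-·U⁻¹ : ∀ A → rowSize (A · inv U) ≡ ∣ c A - (d A + d A) ∣ ℕ.+ ∣ d A ∣
rowSize-·U⁻¹ (mat a b c d) = cong₂ (λ x y → ∣ x ∣ ℕ.+ ∣ y ∣) (left c d) (right c d)
  where left : ∀ c d → c * 1ℤ + d * - + 2 ≡ c - (d + d)
        left = solve-∀
        right : ∀ c d → c * - 0ℤ + d * 1ℤ ≡ d
        right = solve-∀

rowSize-·-I : ∀ A → rowSize (A · -I₂) ≡ rowSize A
rowSize-·-I A =
  P.trans (cong rowSize (·-I≡negate A)) (cong₂ ℕ._+_ (ℤ.∣-i∣≡∣i∣ (c A)) (ℤ.∣-i∣≡∣i∣ (d A)))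

record ClosedUnderGenerators (P : Mat → Set) : Set where
  field
    ·T  : IsΓ₀2 h → P h ⇔ P (h · T)
    ·U  : IsΓ₀2 h → P h ⇔ P (h · U)
    ·-I : IsΓ₀2 h → P h ⇔ P (h · -I₂)

module _ (P : Mat → Set) (P-I : P I₂) (closed : ClosedUnderGenerators P) where
  open ClosedUnderGenerators closed
  open Equivalence

  from-·inv : (∀ {h} → IsΓ₀2 h → P h ⇔ P (h · g)) → IsΓ₀2 g → IsΓ₀2 h → P (h · inv g) → P h
  from-·inv {g} {h} ·g γg γh =
    subst P (·-inv-·-cancel h (sl2 γg)) ∘ to (·g (Γ₀2-· γh (Γ₀2-inv γg)))

  P-Tᵏ⁺ : ∀ n → P (Tᵏ (+ n))
  P-Tᵏ⁺ zero = P-I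
  P-Tᵏ⁺ (suc n) = subst P (Tᵏ-·T (+ n)) (to (·T (Γ₀2-Tᵏ (+ n))) (P-Tᵏ⁺ n))

  P-Tᵏ⁻ : ∀ n → P (Tᵏ -[1+ n ])
  P-Tᵏ⁻ zero = from (·T (Γ₀2-Tᵏ -[1+ 0 ])) (subst P (P.sym (Tᵏ-·T -[1+ 0 ])) P-I)
  P-Tᵏ⁻ (suc n) = from (·T (Γ₀2-Tᵏ -[1+ suc n ])) (subst P (P.sym (Tᵏ-·T -[1+ suc n ])) (P-Tᵏ⁻ n))

  P-Tᵏ : ∀ j → P (Tᵏ j)
  P-Tᵏ (+ n)    = P-Tᵏ⁺ n
  P-Tᵏ -[1+ n ] = P-Tᵏ⁻ n

  P-upper-triangular : ∀ {a b d} → IsΓ₀2 (mat a b 0ℤ d) → P (mat a b 0ℤ d)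
  P-upper-triangular {a} {b} {d} γ with i*j≡1 a d (P.trans (P.sym (det≡ a b d)) (sl2 γ))
    where det≡ : ∀ a b d → a * d - b * 0ℤ ≡ a * d
          det≡ = solve-∀
  ... | inj₁ (P.refl , P.refl) = P-Tᵏ b
  ... | inj₂ (P.refl , P.refl) =
    from (·-I γ) (subst P (P.sym (·-I≡negate (mat (- 1ℤ) b 0ℤ (- 1ℤ)))) (P-Tᵏ (- b)))

  -- Euclid on the bottom row (c, d): for c > 0 (reached from c < 0 via -I) and d ≠ 0 (d is odd),
  -- a T-step shrinks |d| when c ≤ |d| and a U-step shrinks |c| otherwise; c = 0 means h = ±Tᵇ.
  descend : ∀ n {h} → rowSize h < n → IsΓ₀2 h → P h
  descend⁺ : ∀ n {h C} → rowSize h ≤ n → IsΓ₀2 h → c h ≡ +[1+ C ] → P h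
  descend-to : ∀ n {h′ s m} → m ≤ n → rowSize h′ ≡ s → s < m → IsΓ₀2 h′ → P h′

  descend (suc n) {mat a b (+ zero) d} _ γ = P-upper-triangular γ
  descend (suc n) {mat a b +[1+ C ] d} (s≤s size≤n) γ = descend⁺ n size≤n γ P.refl
  descend (suc n) {h@(mat a b -[1+ C ] d)} (s≤s size≤n) γ =
    from (·-I γ) (descend⁺ n (subst (_≤ n) (P.sym (rowSize-·-I h)) size≤n)
                           (Γ₀2-· γ Γ₀2--I) (cong c (·-I≡negate h)))

  descend⁺ n {mat a b _ (+ zero)} _ γ P.refl = ⊥-elim (d≢0 γ P.refl)
  descend⁺ n {h@(mat a b _ +[1+ D ])} {C} size≤n γ P.refl with suc C ℕ.≤? suc D
  ... | yes C≤D = from-·inv ·T Γ₀2-T γ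
    (descend-to n size≤n (rowSize-·T⁻¹ h) (ℕ.+-monoʳ-< (suc C) (∣D-C∣<D C≤D))
                (Γ₀2-· γ (Γ₀2-inv Γ₀2-T)))
  ... | no C≰D = from-·inv ·U Γ₀2-U γ
    (descend-to n size≤n (rowSize-·U⁻¹ h) (ℕ.+-monoˡ-< (suc D) (∣C-2D∣<C C≰D))
                (Γ₀2-· γ (Γ₀2-inv Γ₀2-U)))
  descend⁺ n {h@(mat a b _ -[1+ D ])} {C} size≤n γ P.refl with suc C ℕ.≤? suc D
  ... | yes C≤D = from (·T γ)
    (descend-to n size≤n (rowSize-·T h) (ℕ.+-monoʳ-< (suc C) (∣D-C∣<D C≤D)) (Γ₀2-· γ Γ₀2-T))
  ... | no C≰D = from (·U γ)
    (descend-to n size≤n (rowSize-·U h) (ℕ.+-monoˡ-< (suc D) (∣C-2D∣<C C≰D)) (Γ₀2-· γ Γ₀2-U))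

  descend-to n m≤n P.refl s<m = descend n (ℕ.<-≤-trans s<m m≤n)

  Γ₀2-induction : IsΓ₀2 h → P h
  Γ₀2-induction {h} = descend (suc (rowSize h)) ℕ.≤-refl

-- Exponent sums of T and U

-- For a word in T, U and -I with exponent sums p in T and q in U, the product h satisfies
-- G₁₆ h ≡ 2 (p + q) (mod 16), F₃ h ≡ p + q (mod 3) and c h ≡ 2 q (mod 4).
G₁₆ F₃ : Mat → ℤ
G₁₆ (mat a b c d) = + 2 * b * d + c * d + d * d - 1ℤ
F₃ (mat a b c d) = a * b - a * c - b * d + a * a * b * d

G₁₆-cong : A ≡ᴹ B ⟨mod k ⟩ → G₁₆ A ≡ G₁₆ B ⟨mod k ⟩
G₁₆-cong (entrywise _ b≡ c≡ d≡) = Mod.+-congʳ (- 1ℤ)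
  (Mod.+-cong (Mod.+-cong (Mod.*-cong (Mod.*-congˡ (+ 2) b≡) d≡) (Mod.*-cong c≡ d≡)) (Mod.*-cong d≡ d≡))

F₃-cong : A ≡ᴹ B ⟨mod k ⟩ → F₃ A ≡ F₃ B ⟨mod k ⟩
F₃-cong (entrywise a≡ b≡ c≡ d≡) = Mod.+-cong
  (Mod.+-cong (Mod.+-cong (Mod.*-cong a≡ b≡) (Mod.-‿cong (Mod.*-cong a≡ c≡)))
              (Mod.-‿cong (Mod.*-cong b≡ d≡)))
  (Mod.*-cong (Mod.*-cong (Mod.*-cong a≡ a≡) b≡) d≡)

G₁₆-·-I : ∀ A → G₁₆ (A · -I₂) ≡ G₁₆ A + 0ℤ
G₁₆-·-I A@(mat a b c d) = P.trans (cong G₁₆ (·-I≡negate A)) (even-function a b c d)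
  where even-function : ∀ a b c d →
          + 2 * - b * - d + - c * - d + - d * - d - 1ℤ ≡ + 2 * b * d + c * d + d * d - 1ℤ + 0ℤ
        even-function = solve-∀

F₃-·-I : ∀ A → F₃ (A · -I₂) ≡ F₃ A + 0ℤ
F₃-·-I A@(mat a b c d) = P.trans (cong F₃ (·-I≡negate A)) (even-function a b c d)
  where even-function : ∀ a b c d →
          - a * - b - - a * - c - - b * - d + - a * - a * - b * - d ≡ a * b - a * c - b * d + a * a * b * d + 0ℤ
        even-function = solve-∀

c-·T : ∀ A → c (A · T) ≡ c A + 0ℤ
c-·T (mat a b c d) = unchanged c d
  where unchanged : ∀ c d → c * 1ℤ + d * 0ℤ ≡ c + 0ℤ
        unchanged = solve-∀

record Shifts (g : Mat) (δp δq : ℤ) : Set where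
  field
    G₁₆-shift : IsΓ₀2 h → G₁₆ (h · g) ≡ G₁₆ h + + 2 * (δp + δq) ⟨mod 16 ⟩
    F₃-shift  : IsΓ₀2 h → F₃ (h · g) ≡ F₃ h + (δp + δq) ⟨mod 3 ⟩
    c-shift   : IsΓ₀2 h → c (h · g) ≡ c h + + 2 * δq ⟨mod 4 ⟩

T-shifts : Shifts T 1ℤ 0ℤ
T-shifts = record
  { G₁₆-shift = shift-by-residues 16 G₁₆ G₁₆-cong T (+ 2)
  ; F₃-shift  = shift-by-residues 3 F₃ F₃-cong T 1ℤ
  ; c-shift   = λ {h} _ → Mod.reflexive (c-·T h)
  }

U-shifts : Shifts U 0ℤ 1ℤ
U-shifts = record
  { G₁₆-shift = shift-by-residues 16 G₁₆ G₁₆-cong U (+ 2)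
  ; F₃-shift  = shift-by-residues 3 F₃ F₃-cong U 1ℤ
  ; c-shift   = shift-by-residues 4 c c≡ U (+ 2)
  }

-I-shifts : Shifts -I₂ 0ℤ 0ℤ
-I-shifts = record
  { G₁₆-shift = λ {h} _ → Mod.reflexive (G₁₆-·-I h)
  ; F₃-shift  = λ {h} _ → Mod.reflexive (F₃-·-I h)
  ; c-shift   = shift-by-residues 4 c c≡ -I₂ 0ℤ
  }

module _ {m n : ℕ} {u : ℤ} (order : HasOrder m u n) where

  order-annihilates : ∀ {j} → j ≡ 0ℤ ⟨mod n ⟩ → j * u ≡ 0ℤ ⟨mod m ⟩
  order-annihilates = Mod.annihilate (Mod.fromDefs (proj₁ (proj₂ order)))

  order-divides : ∀ j → j * u ≡ 0ℤ ⟨mod m ⟩ → j ≡ 0ℤ ⟨mod n ⟩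
  order-divides j ju≡0 with proj₁ order | proj₂ (proj₂ order)
  ... | n≥1@(s≤s _) | minimal with j ℤ.%ℕ n in j%n≡r
  ...   | zero = Mod.trans (Mod.residue j n) (Mod.reflexive (cong +_ j%n≡r))
    where instance _ = ℕ.>-nonZero n≥1
  ...   | suc r = ⊥-elim (minimal (suc r) (s≤s z≤n) (subst (_< n) j%n≡r (n%ℕd<d j n)) (Mod.toDefs ru≡0))
    where
      instance _ = ℕ.>-nonZero n≥1
      open Mod.Reasoning m
      split : ∀ r j u → r * u ≡ j * u - (j - r) * u
      split = solve-∀
      ru≡0 : + suc r * u ≡ 0ℤ ⟨mod m ⟩
      ru≡0 = begin
        + suc r * u                ≡⟨ split (+ suc r) j u ⟩
        j * u - (j - + suc r) * u  ≈⟨ Mod.+-cong ju≡0 (Mod.-‿cong (order-annihilates j-r≡0)) ⟩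
        0ℤ                         ∎
        where j-r≡0 = Mod.diff≡0 (Mod.trans (Mod.residue j n) (Mod.reflexive (cong +_ j%n≡r)))

module _ {m : ℕ} (ch : Character m) where

  x u : ℤ
  x = χ ch T
  u = χ ch U

  χ-· : IsΓ₀2 A → IsΓ₀2 B → χ ch (A · B) ≡ χ ch A + χ ch B ⟨mod m ⟩
  χ-· {A} {B} (mkΓ₀2 slA γA) (mkΓ₀2 slB γB) = Mod.fromDefs (hom ch A B slA slB γA γB)

  χ-I : χ ch I₂ ≡ 0ℤ ⟨mod m ⟩
  χ-I = Mod.sym (Mod.+-cancelˡ {x = χ ch I₂} (begin
    χ ch I₂ + 0ℤ       ≡⟨ ℤ.+-identityʳ (χ ch I₂) ⟩
    χ ch (I₂ · I₂)     ≈⟨ χ-· Γ₀2-I Γ₀2-I ⟩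
    χ ch I₂ + χ ch I₂  ∎))
    where open Mod.Reasoning m

  χ-inv : IsΓ₀2 A → χ ch (inv A) ≡ - χ ch A ⟨mod m ⟩
  χ-inv {A} γ = Mod.+-cancelˡ {x = χ ch A} (begin
    χ ch A + χ ch (inv A)  ≈⟨ χ-· γ (Γ₀2-inv γ) ⟨
    χ ch (A · inv A)       ≡⟨ cong (χ ch) (·-inverseʳ {A} (sl2 γ)) ⟩
    χ ch I₂                ≈⟨ χ-I ⟩
    0ℤ                     ≡⟨ ℤ.+-inverseʳ (χ ch A) ⟨
    χ ch A - χ ch A        ∎)
    where open Mod.Reasoning m

  χ--I : χ ch -I₂ ≡ 0ℤ ⟨mod m ⟩
  χ--I = Mod.fromDefs (trivial-on-−I ch)

  χ-Uᵏ⁺ : ∀ n → χ ch (Uᵏ (+ n)) ≡ + n * u ⟨mod m ⟩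
  χ-Uᵏ⁺ zero = χ-I
  χ-Uᵏ⁺ (suc n) = begin
    χ ch (Uᵏ (1ℤ + + n))      ≡⟨ cong (χ ch) (Uᵏ-+ 1ℤ (+ n)) ⟨
    χ ch (U · Uᵏ (+ n))       ≈⟨ χ-· Γ₀2-U (Γ₀2-Uᵏ (+ n)) ⟩
    u + χ ch (Uᵏ (+ n))       ≈⟨ Mod.+-congˡ u (χ-Uᵏ⁺ n) ⟩
    u + + n * u               ≡⟨ distrib (+ n) u ⟩
    (1ℤ + + n) * u            ∎
    where
      open Mod.Reasoning m
      distrib : ∀ n u → u + n * u ≡ (1ℤ + n) * u
      distrib = solve-∀

  χ-Uᵏ : ∀ j → χ ch (Uᵏ j) ≡ j * u ⟨mod m ⟩
  χ-Uᵏ (+ n) = χ-Uᵏ⁺ n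
  χ-Uᵏ -[1+ n ] = begin
    χ ch (Uᵏ (- + suc n))      ≡⟨ cong (χ ch) (Uᵏ-neg (+ suc n)) ⟩
    χ ch (inv (Uᵏ (+ suc n)))  ≈⟨ χ-inv (Γ₀2-Uᵏ (+ suc n)) ⟩
    - χ ch (Uᵏ (+ suc n))      ≈⟨ Mod.-‿cong (χ-Uᵏ⁺ (suc n)) ⟩
    - (+ suc n * u)            ≡⟨ ℤ.neg-distribˡ-* (+ suc n) u ⟩
    -[1+ n ] * u               ∎
    where open Mod.Reasoning m

  -- E has order 2 in PSL₂(ℤ) and E · T = U.
  2[u-x]≡0 : + 2 * (u - x) ≡ 0ℤ ⟨mod m ⟩
  2[u-x]≡0 = begin
    + 2 * (u - x)     ≈⟨ Mod.*-congˡ (+ 2) u-x≡χE ⟩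
    + 2 * χ ch E      ≡⟨ double (χ ch E) ⟩
    χ ch E + χ ch E   ≈⟨ χ-· Γ₀2-E Γ₀2-E ⟨
    χ ch (E · E)      ≈⟨ χ--I ⟩
    0ℤ                ∎
    where
      open Mod.Reasoning m
      E = mat 1ℤ (- 1ℤ) (+ 2) (- 1ℤ)
      Γ₀2-E : IsΓ₀2 E
      Γ₀2-E = mkΓ₀2 P.refl (even E 1ℤ P.refl)
      double : ∀ y → + 2 * y ≡ y + y
      double = solve-∀
      cancel : ∀ y x → y + x - x ≡ y
      cancel = solve-∀
      u-x≡χE : u - x ≡ χ ch E ⟨mod m ⟩
      u-x≡χE = begin
        χ ch (E · T) - x     ≈⟨ Mod.+-congʳ (- x) (χ-· Γ₀2-E Γ₀2-T) ⟩
        χ ch E + x - x       ≡⟨ cancel (χ ch E) x ⟩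
        χ ch E               ∎

  record Tally (h : Mat) : Set where
    constructor mkTally
    field
      p q : ℤ
      G₁₆≡ : G₁₆ h ≡ + 2 * (p + q) ⟨mod 16 ⟩
      F₃≡  : F₃ h ≡ p + q ⟨mod 3 ⟩
      c≡2q : c h ≡ + 2 * q ⟨mod 4 ⟩
      χ≡   : χ ch h ≡ p * x + q * u ⟨mod m ⟩

  tally-step : ∀ {δp δq} → Shifts g δp δq → IsΓ₀2 g → χ ch g ≡ δp * x + δq * u ⟨mod m ⟩ →
               IsΓ₀2 h → Tally h ⇔ Tally (h · g)
  tally-step {g} {h} {δp} {δq} shifts γg χg γh = mk⇔ forward backward
    where
      open Shifts shifts
      χ-shift = Mod.trans (χ-· γh γg) (Mod.+-congˡ (χ ch h) χg)

      shift : ∀ {k X X′ Δ E E′} → X′ ≡ X + Δ ⟨mod k ⟩ → X ≡ E ⟨mod k ⟩ → E + Δ ≡ E′ → X′ ≡ E′ ⟨mod k ⟩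
      shift X′≡X+Δ X≡E E+Δ≡E′ = Mod.trans X′≡X+Δ (Mod.trans (Mod.+-congʳ _ X≡E) (Mod.reflexive E+Δ≡E′))

      unshift : ∀ {k X X′ Δ E E′} → X′ ≡ X + Δ ⟨mod k ⟩ → X′ ≡ E′ ⟨mod k ⟩ → E′ ≡ E + Δ → X ≡ E ⟨mod k ⟩
      unshift X′≡X+Δ X′≡E′ E′≡E+Δ = Mod.+-cancelʳ (Mod.trans (Mod.sym X′≡X+Δ) (Mod.trans X′≡E′ (Mod.reflexive E′≡E+Δ)))

      forward : Tally h → Tally (h · g)
      forward (mkTally p q G≡ F≡ c≡ χ≡) = mkTally (p + δp) (q + δq)
        (shift (G₁₆-shift γh) G≡ (G-sum p q δp δq)) (shift (F₃-shift γh) F≡ (F-sum p q δp δq))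
        (shift (c-shift γh) c≡ (c-sum q δq)) (shift χ-shift χ≡ (χ-sum p q δp δq x u))
        where
          G-sum : ∀ p q δp δq → + 2 * (p + q) + + 2 * (δp + δq) ≡ + 2 * (p + δp + (q + δq))
          G-sum = solve-∀
          F-sum : ∀ p q δp δq → p + q + (δp + δq) ≡ p + δp + (q + δq)
          F-sum = solve-∀
          c-sum : ∀ q δq → + 2 * q + + 2 * δq ≡ + 2 * (q + δq)
          c-sum = solve-∀
          χ-sum : ∀ p q δp δq x u → p * x + q * u + (δp * x + δq * u) ≡ (p + δp) * x + (q + δq) * u
          χ-sum = solve-∀

      backward : Tally (h · g) → Tally h
      backward (mkTally p q G≡ F≡ c≡ χ≡) = mkTally (p - δp) (q - δq)
        (unshift (G₁₆-shift γh) G≡ (G-sum p q δp δq)) (unshift (F₃-shift γh) F≡ (F-sum p q δp δq))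
        (unshift (c-shift γh) c≡ (c-sum q δq)) (unshift χ-shift χ≡ (χ-sum p q δp δq x u))
        where
          G-sum : ∀ p q δp δq → + 2 * (p + q) ≡ + 2 * (p - δp + (q - δq)) + + 2 * (δp + δq)
          G-sum = solve-∀
          F-sum : ∀ p q δp δq → p + q ≡ p - δp + (q - δq) + (δp + δq)
          F-sum = solve-∀
          c-sum : ∀ q δq → + 2 * q ≡ + 2 * (q - δq) + + 2 * δq
          c-sum = solve-∀
          χ-sum : ∀ p q δp δq x u → p * x + q * u ≡ (p - δp) * x + (q - δq) * u + (δp * x + δq * u)
          χ-sum = solve-∀

  tally : IsΓ₀2 h → Tally h
  tally = Γ₀2-induction Tally (mkTally 0ℤ 0ℤ Mod.refl Mod.refl Mod.refl χ-I) (record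
    { ·T  = tally-step T-shifts Γ₀2-T (Mod.reflexive (just-x x u))
    ; ·U  = tally-step U-shifts Γ₀2-U (Mod.reflexive (just-u x u))
    ; ·-I = tally-step -I-shifts Γ₀2--I χ--I
    })
    where just-x : ∀ x u → x ≡ 1ℤ * x + 0ℤ * u
          just-x = solve-∀
          just-u : ∀ x u → u ≡ 0ℤ * x + 1ℤ * u
          just-u = solve-∀

  module _ {n : ℕ} (order : HasOrder m u n) where

    χ-vanishes-on-Γ[48] : n ∣ 24 → IsΓ₀2 h → h ≡ᴹ I₂ ⟨mod 48 ⟩ → χ ch h ≡ 0ℤ ⟨mod m ⟩
    χ-vanishes-on-Γ[48] {h} n∣24 γ h≡I = begin
      χ ch h                     ≈⟨ χ≡ ⟩
      p * x + q * u              ≡⟨ regroup p q x u ⟩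
      (p + q) * x + q * (u - x)  ≈⟨ Mod.+-cong (Mod.annihilate 24x≡0 p+q≡0)
                                               (Mod.annihilate 2[u-x]≡0 q≡0) ⟩
      0ℤ                         ∎
      where
        open Mod.Reasoning m
        open Tally (tally γ)
        regroup : ∀ p q x u → p * x + q * u ≡ (p + q) * x + q * (u - x)
        regroup = solve-∀
        eliminate-u : ∀ x u → + 24 * x ≡ + 24 * u - + 12 * (+ 2 * (u - x))
        eliminate-u = solve-∀
        24x≡0 : + 24 * x ≡ 0ℤ ⟨mod m ⟩
        24x≡0 = begin
          + 24 * x                           ≡⟨ eliminate-u x u ⟩
          + 24 * u - + 12 * (+ 2 * (u - x))  ≈⟨ Mod.+-cong (order-annihilates order (Mod.fromℕ∣ n∣24))
                                                           (Mod.-‿cong (Mod.*-congˡ (+ 12) 2[u-x]≡0)) ⟩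
          0ℤ                                 ∎
        p+q≡0 : p + q ≡ 0ℤ ⟨mod 24 ⟩
        p+q≡0 = ≡0-mod-* {8} {3} (- 1ℤ , + 3 , P.refl)
          (Mod.cancel 2 (Mod.trans (Mod.sym G₁₆≡) (G₁₆-cong (≡ᴹ-weaken (ℕ.divides 3 P.refl) h≡I))))
          (Mod.trans (Mod.sym F₃≡) (F₃-cong (≡ᴹ-weaken (ℕ.divides 16 P.refl) h≡I)))
        q≡0 : q ≡ 0ℤ ⟨mod 2 ⟩
        q≡0 = Mod.cancel 2 (Mod.trans (Mod.sym c≡2q) (c≡ (≡ᴹ-weaken (ℕ.divides 12 P.refl) h≡I)))

    Γ[48]⊆ker : n ∣ 24 → IsSL2 A → A ≡ᴹ I₂ ⟨mod 48 ⟩ → InKerInd ch A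
    Γ[48]⊆ker {A} n∣24 det≡1 A≡I i = c-even γ , Mod.toDefs (χ-vanishes-on-Γ[48] n∣24 γ conjugate≡I)
      where
        r = cosetRep i
        conjugate≡I : inv r · A · r ≡ᴹ I₂ ⟨mod 48 ⟩
        conjugate≡I = Γ-normal r (cosetRep-SL2 i) A≡I
        γ : IsΓ₀2 (inv r · A · r)
        sl-r = cosetRep-SL2 i
        γ = mkΓ₀2 (SL2-· {inv r · A} {r} (SL2-· {inv r} {A} (SL2-inv {r} sl-r) det≡1) sl-r)
                  (Γ[2]⊆Γ₀2 (≡ᴹ-weaken (ℕ.divides 24 P.refl) conjugate≡I))

  module _ {N : ℕ} (Γ[N]⊆ker : ∀ A → IsSL2 A → ≡I[mod N ] A → InKerInd ch A) where

    χ-vanishes-on-Γ[N] : IsSL2 A → A ≡ᴹ I₂ ⟨mod N ⟩ → χ ch A ≡ 0ℤ ⟨mod m ⟩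
    χ-vanishes-on-Γ[N] {A} det≡1 A≡I =
      subst (λ B → χ ch B ≡ 0ℤ ⟨mod m ⟩) conjugate-by-I
            (Mod.fromDefs (proj₂ (Γ[N]⊆ker A det≡1 (toΓ A≡I) zero)))
      where conjugate-by-I : inv I₂ · A · I₂ ≡ A
            conjugate-by-I = P.trans (·-identityʳ (I₂ · A)) (·-identityˡ A)

    module _ {n : ℕ} (order : HasOrder m u n) where

      n∣N : n ∣ N
      n∣N = Mod.toℕ∣ (order-divides order (+ N)
              (Mod.trans (Mod.sym (χ-Uᵏ (+ N))) (χ-vanishes-on-Γ[N] P.refl Uᴺ≡I)))
        where Uᴺ≡I : Uᵏ (+ N) ≡ᴹ I₂ ⟨mod N ⟩
              Uᴺ≡I = entrywise Mod.refl Mod.refl (Mod.multiple (+ 2) (ℤ.+-identityʳ (+ 2 * + N))) Mod.refl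

      -- D U D⁻¹ U^(-d²) lies in Γ(N) and χ maps it to (1 - d²) u.
      d²≡1 : IsΓ₀2 A → b A ≡ 0ℤ ⟨mod N ⟩ → d A * d A ≡ 1ℤ ⟨mod n ⟩
      d²≡1 {A} γ b≡0 = Mod.sym (Mod.diff≡0⇒≡ (order-divides order (1ℤ - s) [1-s]u≡0))
        where
          open Mod.Reasoning m
          s = d A * d A
          Z = A · U · inv A · Uᵏ (- s)
          Γ₀2-AUA⁻¹ = Γ₀2-· (Γ₀2-· γ Γ₀2-U) (Γ₀2-inv γ)
          Z≡I : Z ≡ᴹ I₂ ⟨mod N ⟩
          Z≡I = ≡ᴹ-trans (·-congˡ (Uᵏ (- s)) (conjugate-U≡Uᵏ {A} (sl2 γ) b≡0))
                  (≡ᴹ-reflexive (P.trans (Uᵏ-+ s (- s)) (cong Uᵏ (ℤ.+-inverseʳ s))))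
          collect : ∀ X u s → (1ℤ - s) * u ≡ X + u + - X + - s * u
          collect = solve-∀
          [1-s]u≡0 : (1ℤ - s) * u ≡ 0ℤ ⟨mod m ⟩
          [1-s]u≡0 = begin
            (1ℤ - s) * u
              ≡⟨ collect (χ ch A) u s ⟩
            χ ch A + u + - χ ch A + - s * u
              ≈⟨ Mod.+-cong (Mod.+-cong (χ-· γ Γ₀2-U) (χ-inv γ)) (χ-Uᵏ (- s)) ⟨
            χ ch (A · U) + χ ch (inv A) + χ ch (Uᵏ (- s))
              ≈⟨ Mod.+-congʳ _ (χ-· (Γ₀2-· γ Γ₀2-U) (Γ₀2-inv γ)) ⟨
            χ ch (A · U · inv A) + χ ch (Uᵏ (- s))
              ≈⟨ χ-· Γ₀2-AUA⁻¹ (Γ₀2-Uᵏ (- s)) ⟨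
            χ ch Z
              ≈⟨ χ-vanishes-on-Γ[N] (sl2 (Γ₀2-· Γ₀2-AUA⁻¹ (Γ₀2-Uᵏ (- s)))) Z≡I ⟩
            0ℤ ∎

-- Moduli in which every unit squares to 1

data ThreeSmooth : ℕ → Set where
  one : ThreeSmooth 1
  2* : ∀ {S} → ThreeSmooth S → ThreeSmooth (2 ℕ.* S)
  3* : ∀ {S} → ThreeSmooth S → ThreeSmooth (3 ℕ.* S)

Bézout-smooth : ∀ {S z} → ThreeSmooth S → Bézout (+ 2) z → Bézout (+ 3) z → Bézout (+ S) z
Bézout-smooth one        _   _   = 1ℤ , 0ℤ , P.refl
Bézout-smooth (2* {S} s) 2⊥z 3⊥z =
  subst (λ t → Bézout t _) (P.sym (ℤ.pos-* 2 S)) (Bézout-*ˡ 2⊥z (Bézout-smooth s 2⊥z 3⊥z))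
Bézout-smooth (3* {S} s) 2⊥z 3⊥z =
  subst (λ t → Bézout t _) (P.sym (ℤ.pos-* 3 S)) (Bézout-*ˡ 3⊥z (Bézout-smooth s 2⊥z 3⊥z))

record SmoothSplit (M : ℕ) : Set where
  constructor split
  field
    smooth cofactor : ℕ
    smooth-part : ThreeSmooth smooth
    product : smooth ℕ.* cofactor ≡ M
    2⊥cofactor : Bézout (+ 2) (+ cofactor)
    3⊥cofactor : Bézout (+ 3) (+ cofactor)

SmoothSplit-* : ∀ {M q} p → (∀ {S} → ThreeSmooth S → ThreeSmooth (p ℕ.* S)) →
                M ≡ q ℕ.* p → SmoothSplit q → SmoothSplit M
SmoothSplit-* {M} {q} p p* M≡qp (split S M₀ s SM₀≡q 2⊥M₀ 3⊥M₀) = split (p ℕ.* S) M₀ (p* s) (begin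
  p ℕ.* S ℕ.* M₀    ≡⟨ ℕ.*-assoc p S M₀ ⟩
  p ℕ.* (S ℕ.* M₀)  ≡⟨ cong (p ℕ.*_) SM₀≡q ⟩
  p ℕ.* q           ≡⟨ ℕ.*-comm p q ⟩
  q ℕ.* p           ≡⟨ M≡qp ⟨
  M                 ∎) 2⊥M₀ 3⊥M₀
  where open P.≡-Reasoning

residue-Bézout : ∀ {M p r} .{{_ : NonZero p}} → M ℕ.% p ≡ r → Bézout (+ r) (+ p) → Bézout (+ p) (+ M)
residue-Bézout {M} {p} M%p≡r r⊥p =
  Bézout-sym (Bézout-cong (Mod.trans (Mod.residue (+ M) p) (Mod.reflexive (cong +_ M%p≡r))) r⊥p)

%-< : ∀ {M p r} .{{_ : NonZero p}} → M ℕ.% p ≡ r → r < p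
%-< {M} {p} M%p≡r = subst (_< p) M%p≡r (ℕ.m%n<n M p)

smoothSplit : ∀ M → SmoothSplit (suc M)
smoothSplit M = go M (<-wellFounded (suc M))
  where
    divide-out : ∀ {M} p → 1 < p → (∀ {S} → ThreeSmooth S → ThreeSmooth (p ℕ.* S)) → p ∣ suc M →
                 (∀ {q} → suc q < suc M → SmoothSplit (suc q)) → SmoothSplit (suc M)
    divide-out p 1<p p* (ℕ.divides (suc q) M≡qp) recurse =
      SmoothSplit-* p p* M≡qp (recurse (subst (suc q <_) (P.sym M≡qp) (ℕ.m<m*n (suc q) p 1<p)))
    coprime-to-6 : ∀ {M} → Bézout (+ 2) (+ suc M) → Bézout (+ 3) (+ suc M) → SmoothSplit (suc M)
    coprime-to-6 {M} = split 1 (suc M) one (ℕ.*-identityˡ (suc M))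
    go : ∀ M → Acc _<_ (suc M) → SmoothSplit (suc M)
    go M (acc rec) with suc M ℕ.% 2 in r₂ | suc M ℕ.% 3 in r₃
    ... | 0 | _ = divide-out 2 (s≤s (s≤s z≤n)) 2* (ℕ.m%n≡0⇒n∣m (suc M) 2 r₂) (go _ ∘ rec)
    ... | 1 | 0 = divide-out 3 (s≤s (s≤s z≤n)) 3* (ℕ.m%n≡0⇒n∣m (suc M) 3 r₃) (go _ ∘ rec)
    ... | 1 | 1 = coprime-to-6 (residue-Bézout r₂ (1ℤ , 0ℤ , P.refl)) (residue-Bézout r₃ (1ℤ , 0ℤ , P.refl))
    ... | 1 | 2 = coprime-to-6 (residue-Bézout r₂ (1ℤ , 0ℤ , P.refl)) (residue-Bézout r₃ (- 1ℤ , 1ℤ , P.refl))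
    ... | 1 | suc (suc (suc _)) with %-< {suc M} {3} r₃
    ...   | s≤s (s≤s (s≤s ()))
    go M (acc rec) | suc (suc _) | _ with %-< {suc M} {2} r₂
    ...   | s≤s (s≤s ())

∣left-factor : ∀ {n S M₀ e t} → n ∣ S ℕ.* M₀ → e ≡ 0ℤ ⟨mod n ⟩ → e ≡ t ⟨mod M₀ ⟩ → Bézout (+ M₀) t →
               n ∣ S
∣left-factor {n} {S} {M₀} {e} {t} n∣SM₀ e≡0 e≡t (α , β , αM₀+βt≡1) = Mod.toℕ∣ (begin
  + S                                ≡⟨ P.sym (P.trans (cong (+ S *_) αM₀+βt≡1) (ℤ.*-identityʳ (+ S))) ⟩
  + S * (α * + M₀ + β * t)           ≡⟨ regroup (+ S) (+ M₀) α β t ⟩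
  α * (+ S * + M₀) + β * (+ S * t)   ≈⟨ Mod.+-cong (Mod.*-congˡ α SM₀≡0) (Mod.*-congˡ β St≡0) ⟩
  α * 0ℤ + β * 0ℤ                    ≡⟨ vanish α β ⟩
  0ℤ                                 ∎)
  where
    open Mod.Reasoning n
    regroup : ∀ S M₀ α β t → S * (α * M₀ + β * t) ≡ α * (S * M₀) + β * (S * t)
    regroup = solve-∀
    vanish : ∀ α β → α * 0ℤ + β * 0ℤ ≡ 0ℤ
    vanish = solve-∀
    SM₀≡0 : + S * + M₀ ≡ 0ℤ ⟨mod n ⟩
    SM₀≡0 = subst (λ y → y ≡ 0ℤ ⟨mod n ⟩) (ℤ.pos-* S M₀) (Mod.fromℕ∣ n∣SM₀)
    St≡0 : + S * t ≡ 0ℤ ⟨mod n ⟩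
    St≡0 = begin
      + S * t    ≈⟨ Mod.weaken n∣SM₀ (Mod.scale S (Mod.sym e≡t)) ⟩
      + S * e    ≈⟨ Mod.*-congˡ (+ S) e≡0 ⟩
      + S * 0ℤ   ≡⟨ ℤ.*-zeroʳ (+ S) ⟩
      0ℤ         ∎

squares≡1⇒∣24 : ∀ {n M} → n ∣ suc M → (∀ w → Bézout w (+ suc M) → w * w ≡ 1ℤ ⟨mod n ⟩) →
                n ∣ 24
squares≡1⇒∣24 {n} {M} n∣M squares≡1 = Mod.toℕ∣ (begin
  + 24        ≈⟨ Mod.weaken n∣S (Mod.sym w²-1≡24) ⟩
  w * w - 1ℤ  ≈⟨ w²-1≡0 ⟩
  0ℤ          ∎)
  where
    open Mod.Reasoning n
    open SmoothSplit (smoothSplit M) renaming (smooth to S; cofactor to M₀)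
    S⊥M₀ : Bézout (+ S) (+ M₀)
    S⊥M₀ = Bézout-smooth smooth-part 2⊥cofactor 3⊥cofactor
    S⊥5 : Bézout (+ S) (+ 5)
    S⊥5 = Bézout-smooth smooth-part (+ 3 , - 1ℤ , P.refl) (+ 2 , - 1ℤ , P.refl)
    solution = chinese-remainder S⊥M₀ (+ 5) (+ 2)
    w = proj₁ solution
    w≡5 = proj₁ (proj₂ solution)
    w≡2 = proj₂ (proj₂ solution)
    w⊥M : Bézout w (+ suc M)
    w⊥M = subst (Bézout w) (P.trans (P.sym (ℤ.pos-* S M₀)) (cong +_ product))
      (Bézout-*ʳ (Bézout-cong w≡5 (Bézout-sym S⊥5)) (Bézout-cong w≡2 2⊥cofactor))
    w²-1≡0 : w * w - 1ℤ ≡ 0ℤ ⟨mod n ⟩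
    w²-1≡0 = Mod.diff≡0 (squares≡1 w w⊥M)
    w²-1≡24 : w * w - 1ℤ ≡ + 24 ⟨mod S ⟩
    w²-1≡24 = Mod.+-congʳ (- 1ℤ) (Mod.*-cong w≡5 w≡5)
    w²-1≡3 : w * w - 1ℤ ≡ + 3 ⟨mod M₀ ⟩
    w²-1≡3 = Mod.+-congʳ (- 1ℤ) (Mod.*-cong w≡2 w≡2)
    n∣S : n ∣ S
    n∣S = ∣left-factor (subst (n ∣_) (P.sym product) n∣M) w²-1≡0 w²-1≡3 (Bézout-sym 3⊥cofactor)

Bézout⇒Γ₀2 : ∀ {N w} → Bézout w (+ (2 ℕ.* N)) → ∃ λ D → IsΓ₀2 D × b D ≡ 0ℤ ⟨mod N ⟩ × d D ≡ w
Bézout⇒Γ₀2 {N} {w} (α , β , αw+2Nβ≡1) =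
  D , mkΓ₀2 det≡1 (even D (- β) (ℤ.*-comm (+ 2) (- β))) , Mod.modulus≡0 , P.refl
  where
    D = mat α (+ N) (+ 2 * - β) w
    expand : ∀ α β w N → α * w - N * (+ 2 * - β) ≡ α * w + β * (+ 2 * N)
    expand = solve-∀
    det≡1 : det D ≡ 1ℤ
    det≡1 = P.trans (expand α β w (+ N))
                    (P.trans (cong (λ t → α * w + β * t) (P.sym (ℤ.pos-* 2 N))) αw+2Nβ≡1)

theorem2p5 : (m : ℕ) → .{{_ : NonZero m}} → (ch : Character m) → (n : ℕ) → HasOrder m (χ ch U) n → (IsCongruence (InKerInd ch) → n ∣ 24) × (n ∣ 24 → IsCongruence (InKerInd ch))
theorem2p5 m ch n order = only-if , if
  where
    if : n ∣ 24 → IsCongruence (InKerInd ch)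
    if n∣24 = 48 , s≤s z≤n , λ A det≡1 A≡I → Γ[48]⊆ker ch order n∣24 det≡1 (fromΓ A≡I)
    only-if : IsCongruence (InKerInd ch) → n ∣ 24
    only-if (suc N , _ , Γ[N]⊆ker) = squares≡1⇒∣24 (ℕ.∣n⇒∣m*n 2 (n∣N ch Γ[N]⊆ker order)) squares≡1
      where
        squares≡1 : ∀ w → Bézout w (+ (2 ℕ.* suc N)) → w * w ≡ 1ℤ ⟨mod n ⟩
        squares≡1 w w⊥2N with Bézout⇒Γ₀2 w⊥2N
        ... | D , γ , b≡0 , P.refl = d²≡1 ch Γ[N]⊆ker order γ b≡0
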